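{- Let $S$ and $T$ be disjoint nonempty finite sets, $V=S\cup T$, and let $p_T$ be a positively intersecting supermodular set-function on $T$ with $p_T(\emptyset)=0$ and $p_T(Y)\le|S|$ for every $Y\subseteq T$. Define $b_0$ on subsets of $V$ by $$b_0(X\cup Z)=\min\{\,|T-Z|\,|X|-\widetilde p_T(\mathcal T)+|\mathcal T|\,|X|\ :\ \mathcal T\text{ a subpartition of }Z\,\}\qquad(X\subseteq S,\ Z\subseteq T).$$ Then $b_0$ is fully submodular, i.e. $b_0(U_1)+b_0(U_2)\ge b_0(U_1\cap U_2)+b_0(U_1\cup U_2)$ for all $U_1,U_2\subseteq V$.
   Context: A subpartition of $Z$ is a family of pairwise disjoint nonempty subsets of $Z$ (the empty family is allowed); $\widetilde p_T(\mathcal T)=\sum_{W\in\mathcal T}p_T(W)$, which is $0$ for the empty family. $p_T$ is positively intersecting supermodular if $p_T(X)+p_T(Y)\le p_T(X\cap Y)+p_T(X\cup Y)$ whenever $X\cap Y\ne\emptyset$, $p_T(X)>0$, $p_T(Y)>0$. -}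

module Defs where

open import Data.Nat using (ℕ; suc)
open import Data.Integer using (ℤ; +_; _+_; _-_; _*_; _≤_; _<_)
open import Data.Fin.Subset using (Subset; ⊥; _∩_; _∪_; ∁; ∣_∣; _⊆_; Nonempty; Empty)
open import Data.List using (List; length; foldr)
open import Data.List.Relation.Unary.All using (All)
open import Data.List.Relation.Unary.AllPairs using (AllPairs)
open import Data.Product using (Σ; _×_)
open import Relation.Binary.PropositionalEquality using (_≡_)

-- The ground set T is Fin t; set functions on T are maps Subset t → ℤ.
SetFn : ℕ → Set
SetFn t = Subset t → ℤ

PosIntersectingSupermodular : ∀ {t} → SetFn t → Set
PosIntersectingSupermodular {t} p =
  ∀ (X Y : Subset t) → Nonempty (X ∩ Y) → + 0 < p X → + 0 < p Y →
  p X + p Y ≤ p (X ∩ Y) + p (X ∪ Y)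

IsSubpartition : ∀ {t} → Subset t → List (Subset t) → Set
IsSubpartition Z 𝒯 =
  All (λ W → Nonempty W × W ⊆ Z) 𝒯 × AllPairs (λ A B → Empty (A ∩ B)) 𝒯

p̃ : ∀ {t} → SetFn t → List (Subset t) → ℤ
p̃ p 𝒯 = foldr (λ W acc → p W + acc) (+ 0) 𝒯

b0-objective : ∀ {s t} → SetFn t → Subset s → Subset t → List (Subset t) → ℤ
b0-objective p X Z 𝒯 =
  (+ ∣ ∁ Z ∣) * (+ ∣ X ∣) - p̃ p 𝒯 + (+ length 𝒯) * (+ ∣ X ∣)

IsMinObjective : ∀ {s t} → SetFn t → Subset s → Subset t → ℤ → Set
IsMinObjective p X Z m =
  Σ (List _) (λ 𝒯 → IsSubpartition Z 𝒯 × b0-objective p X Z 𝒯 ≡ m)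
  × (∀ 𝒯 → IsSubpartition Z 𝒯 → m ≤ b0-objective p X Z 𝒯)

-- Write b0(X ∪ Z) = |T − Z| |X| + min over subpartitions 𝒯 of Z of Σ_{W ∈ 𝒯} (|X| − p W), take
-- optimal 𝒯₁ for (X₁, Z₁) and 𝒯₂ for (X₂, Z₂), and let |X₁ ∩ X₂| = a, |X₁| = a + d, |X₂| = a + e,
-- so that |X₁ ∪ X₂| = a + d + e. Subpartitions 𝒜 of Z₁ ∩ Z₂ (weight a) and ℬ of Z₁ ∪ Z₂
-- (weight a + d + e) are built by uncrossing: a set of one family that meets a set of the other,
-- both with positive p, is replaced by their intersection, which goes to 𝒜, and their union;
-- the weights before sum to at least a + (a + d + e), so positively intersecting supermodularity
-- pays for the step. Sets with p ≤ 0 are dropped, which does not increase the cost. The sets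
-- that remain are disjoint; each goes to 𝒜 if it lies in Z₁ ∩ Z₂, and to ℬ otherwise, where its
-- extra weight e (or d) is paid by an element of it in Z₁ ∖ Z₂ (or Z₂ ∖ Z₁), since elementwise
--   |T − Z₁| (a + d) + |T − Z₂| (a + e)
--     = |T − Z₁ ∩ Z₂| a + |T − Z₁ ∪ Z₂| (a + d + e) + e |Z₁ ∖ Z₂| + d |Z₂ ∖ Z₁|.

module Submission where

open import Data.Bool using (Bool)
open import Data.Empty using (⊥-elim)
open import Data.Fin using (Fin; zero; suc)
import Data.Fin.Properties as Fin
open import Data.Fin.Subset
  using (Subset; ⊥; _∩_; _∪_; ∁; ∣_∣; ⋃; _⊆_; _∈_; _∉_; Nonempty; Empty; inside; outside)
open import Data.Fin.Subset.Properties
  using (x∈p∩q⁺; x∈p∩q⁻; x∈p∪q⁻; p⊆p∪q; q⊆p∪q; ∉⊥; drop-∷-Empty; _∈?_; nonempty?; ⊆-trans;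
         ∣p∩q∣≤∣p∣; ∣p∩q∣≤∣q∣)
open import Data.Integer using (ℤ; +_; 0ℤ; _+_; _-_; -_; _*_; _≤_; _<_; +≤+)
import Data.Integer.Properties as ℤ
open import Data.Integer.Tactic.RingSolver using (solve-∀)
open import Data.List as List using (List; []; _∷_; length; foldr)
open import Data.List.Properties using (length-removeAt′)
open import Data.List.Relation.Unary.All as All using (All; []; _∷_)
import Data.List.Relation.Unary.All.Properties as All
open import Data.List.Relation.Unary.AllPairs as AllPairs using (AllPairs; []; _∷_)
import Data.List.Relation.Unary.AllPairs.Properties as AllPairs
open import Data.List.Relation.Unary.Any as Any using (Any; here; there; _─_)
open import Data.Nat as ℕ using (ℕ; suc; _∸_)
import Data.Nat.Properties as ℕ
open import Data.Nat.ListAction using (sum)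
import Data.Nat.Tactic.RingSolver as ℕ-Solver
open import Data.Product using (_×_; _,_; proj₁; proj₂; ∃; ∃₂)
import Data.Product as Product
open import Data.Sum using (_⊎_; inj₁; inj₂; [_,_]′)
open import Data.Unit using (⊤; tt)
open import Data.Vec as Vec using (Vec; []; _∷_; here; there; zipWith)
open import Function using (_∘_; _on_)
open import Relation.Binary.Definitions using (Symmetric)
open import Relation.Nullary using (yes; no)
open import Relation.Nullary.Decidable using (_×-dec_; ¬?; decidable-stable)
open import Relation.Binary.PropositionalEquality
  using (_≡_; refl; sym; trans; cong; cong₂; subst; subst₂; module ≡-Reasoning)

open import Defs

module _ {n : ℕ} {A B : Subset n} {x : Fin n} where

  ∩⁻ˡ : x ∈ A ∩ B → x ∈ A
  ∩⁻ˡ = proj₁ ∘ x∈p∩q⁻ A B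

  ∩⁻ʳ : x ∈ A ∩ B → x ∈ B
  ∩⁻ʳ = proj₂ ∘ x∈p∩q⁻ A B

  ∩⁺ : x ∈ A → x ∈ B → x ∈ A ∩ B
  ∩⁺ x∈A x∈B = x∈p∩q⁺ (x∈A , x∈B)

  ∪⁺ˡ : x ∈ A → x ∈ A ∪ B
  ∪⁺ˡ = p⊆p∪q B

  ∪⁺ʳ : x ∈ B → x ∈ A ∪ B
  ∪⁺ʳ = q⊆p∪q A B

  ∪⁻ : x ∈ A ∪ B → x ∈ A ⊎ x ∈ B
  ∪⁻ = x∈p∪q⁻ A B

Disjoint : ∀ {n} → Subset n → Subset n → Set
Disjoint A B = Empty (A ∩ B)

disjoint⁺ : ∀ {n} {A B : Subset n} → (∀ {x} → x ∈ A → x ∉ B) → Disjoint A B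
disjoint⁺ f (x , x∈A∩B) = f (∩⁻ˡ x∈A∩B) (∩⁻ʳ x∈A∩B)

disjoint⁻ : ∀ {n} {A B : Subset n} → Disjoint A B → ∀ {x} → x ∈ A → x ∉ B
disjoint⁻ D x∈A x∈B = D (_ , ∩⁺ x∈A x∈B)

Disjoint-sym : ∀ {n} {A B : Subset n} → Disjoint A B → Disjoint B A
Disjoint-sym D = disjoint⁺ λ x∈B x∈A → disjoint⁻ D x∈A x∈B

Disjoint-⊆ˡ : ∀ {n} {A B C : Subset n} → A ⊆ B → Disjoint B C → Disjoint A C
Disjoint-⊆ˡ A⊆B D = disjoint⁺ (disjoint⁻ D ∘ A⊆B)

Disjoint-⊆ʳ : ∀ {n} {A B C : Subset n} → B ⊆ C → Disjoint A C → Disjoint A B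
Disjoint-⊆ʳ B⊆C D = disjoint⁺ λ x∈A → disjoint⁻ D x∈A ∘ B⊆C

Disjoint-∪ˡ : ∀ {n} {A B C : Subset n} → Disjoint A C → Disjoint B C → Disjoint (A ∪ B) C
Disjoint-∪ˡ D D′ = disjoint⁺ λ x∈A∪B → [ disjoint⁻ D , disjoint⁻ D′ ]′ (∪⁻ x∈A∪B)

Disjoint-∪ʳ : ∀ {n} {A B C : Subset n} → Disjoint A B → Disjoint A C → Disjoint A (B ∪ C)
Disjoint-∪ʳ D D′ = disjoint⁺ λ x∈A → [ disjoint⁻ D x∈A , disjoint⁻ D′ x∈A ]′ ∘ ∪⁻

Disjoint-⊥ : ∀ {n} (A : Subset n) → Disjoint A ⊥
Disjoint-⊥ A = disjoint⁺ λ _ → ∉⊥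

Disjoint-⋃ : ∀ {n} {A : Subset n} {Bs} → All (Disjoint A) Bs → Disjoint A (⋃ Bs)
Disjoint-⋃ []       = Disjoint-⊥ _
Disjoint-⋃ (D ∷ Ds) = Disjoint-∪ʳ D (Disjoint-⋃ Ds)

Disjoint⇒∩⊆ : ∀ {n} {A B C : Subset n} → Disjoint A B → A ∩ B ⊆ C
Disjoint⇒∩⊆ D x∈A∩B = ⊥-elim (disjoint⁻ D (∩⁻ˡ x∈A∩B) (∩⁻ʳ x∈A∩B))

⊆-∩⁺ : ∀ {n} {A B C : Subset n} → A ⊆ B → A ⊆ C → A ⊆ B ∩ C
⊆-∩⁺ A⊆B A⊆C x∈A = ∩⁺ (A⊆B x∈A) (A⊆C x∈A)

∪∩⊆∩ : ∀ {n} {A M M′ : Subset n} → Disjoint M M′ → (A ∪ M) ∩ M′ ⊆ A ∩ M′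
∪∩⊆∩ M∩M′≡∅ x∈ =
  [ (λ x∈A → ∩⁺ x∈A (∩⁻ʳ x∈)) , (λ x∈M → ⊥-elim (disjoint⁻ M∩M′≡∅ x∈M (∩⁻ʳ x∈))) ]′ (∪⁻ (∩⁻ˡ x∈))

∩∪⊆ : ∀ {n} {A B C D : Subset n} → A ∩ B ⊆ D → A ∩ C ⊆ D → A ∩ (B ∪ C) ⊆ D
∩∪⊆ A∩B⊆D A∩C⊆D x∈ =
  [ (λ x∈B → A∩B⊆D (∩⁺ (∩⁻ˡ x∈) x∈B)) , (λ x∈C → A∩C⊆D (∩⁺ (∩⁻ˡ x∈) x∈C)) ]′ (∪⁻ (∩⁻ʳ x∈))

⊆-or-counterexample : ∀ {n} (A B : Subset n) → A ⊆ B ⊎ ∃ λ x → x ∈ A × x ∉ B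
⊆-or-counterexample A B with Fin.any? (λ x → x ∈? A ×-dec ¬? (x ∈? B))
... | yes counterexample = inj₂ counterexample
... | no none = inj₁ λ {x} x∈A → decidable-stable (x ∈? B) (λ x∉B → none (x , x∈A , x∉B))

∣p∩q∣+∣p∪q∣≡∣p∣+∣q∣ : ∀ {n} (A B : Subset n) → ∣ A ∩ B ∣ ℕ.+ ∣ A ∪ B ∣ ≡ ∣ A ∣ ℕ.+ ∣ B ∣
∣p∩q∣+∣p∪q∣≡∣p∣+∣q∣ []            []            = refl
∣p∩q∣+∣p∪q∣≡∣p∣+∣q∣ (inside  ∷ A) (inside  ∷ B) =
  cong suc (trans (ℕ.+-suc _ _) (trans (cong suc (∣p∩q∣+∣p∪q∣≡∣p∣+∣q∣ A B)) (sym (ℕ.+-suc _ _))))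
∣p∩q∣+∣p∪q∣≡∣p∣+∣q∣ (inside  ∷ A) (outside ∷ B) = trans (ℕ.+-suc _ _) (cong suc (∣p∩q∣+∣p∪q∣≡∣p∣+∣q∣ A B))
∣p∩q∣+∣p∪q∣≡∣p∣+∣q∣ (outside ∷ A) (inside  ∷ B) =
  trans (ℕ.+-suc _ _) (trans (cong suc (∣p∩q∣+∣p∪q∣≡∣p∣+∣q∣ A B)) (sym (ℕ.+-suc _ _)))
∣p∩q∣+∣p∪q∣≡∣p∣+∣q∣ (outside ∷ A) (outside ∷ B) = ∣p∩q∣+∣p∪q∣≡∣p∣+∣q∣ A B

-- Weighted cardinality

weight : ∀ {n} → Vec ℕ n → Subset n → ℕ
weight []       []            = 0
weight (w ∷ ws) (inside  ∷ A) = w ℕ.+ weight ws A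
weight (w ∷ ws) (outside ∷ A) = weight ws A

weight-⊥ : ∀ {n} (ws : Vec ℕ n) → weight ws ⊥ ≡ 0
weight-⊥ []       = refl
weight-⊥ (w ∷ ws) = weight-⊥ ws

weight-∪ : ∀ {n} (ws : Vec ℕ n) (A B : Subset n) → Disjoint A B →
           weight ws (A ∪ B) ≡ weight ws A ℕ.+ weight ws B
weight-∪ []       []            []            D = refl
weight-∪ (w ∷ ws) (inside  ∷ A) (inside  ∷ B) D = ⊥-elim (D (zero , here))
weight-∪ (w ∷ ws) (inside  ∷ A) (outside ∷ B) D =
  trans (cong (w ℕ.+_) (weight-∪ ws A B (drop-∷-Empty D))) (sym (ℕ.+-assoc w _ _))
weight-∪ (w ∷ ws) (outside ∷ A) (inside  ∷ B) D = begin
  w ℕ.+ weight ws (A ∪ B)                 ≡⟨ cong (w ℕ.+_) (weight-∪ ws A B (drop-∷-Empty D)) ⟩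
  w ℕ.+ (weight ws A ℕ.+ weight ws B)     ≡⟨ sym (ℕ.+-assoc w _ _) ⟩
  (w ℕ.+ weight ws A) ℕ.+ weight ws B     ≡⟨ cong (ℕ._+ weight ws B) (ℕ.+-comm w _) ⟩
  (weight ws A ℕ.+ w) ℕ.+ weight ws B     ≡⟨ ℕ.+-assoc (weight ws A) w _ ⟩
  weight ws A ℕ.+ (w ℕ.+ weight ws B)     ∎
  where open ≡-Reasoning
weight-∪ (w ∷ ws) (outside ∷ A) (outside ∷ B) D = weight-∪ ws A B (drop-∷-Empty D)

weight-≤-sum : ∀ {n} (ws : Vec ℕ n) (A : Subset n) → weight ws A ℕ.≤ Vec.sum ws
weight-≤-sum []       []            = ℕ.z≤n
weight-≤-sum (w ∷ ws) (inside  ∷ A) = ℕ.+-monoʳ-≤ w (weight-≤-sum ws A)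
weight-≤-sum (w ∷ ws) (outside ∷ A) = ℕ.≤-trans (weight-≤-sum ws A) (ℕ.m≤n+m _ w)

lookup-≤-weight : ∀ {n} (ws : Vec ℕ n) {A : Subset n} {x} → x ∈ A → Vec.lookup ws x ℕ.≤ weight ws A
lookup-≤-weight (w ∷ ws) {inside  ∷ A} here        = ℕ.m≤m+n w _
lookup-≤-weight (w ∷ ws) {inside  ∷ A} (there x∈A) = ℕ.≤-trans (lookup-≤-weight ws x∈A) (ℕ.m≤n+m _ w)
lookup-≤-weight (w ∷ ws) {outside ∷ A} (there x∈A) = lookup-≤-weight ws x∈A

weight-⋃ : ∀ {n} (ws : Vec ℕ n) {As : List (Subset n)} → AllPairs Disjoint As →
           sum (List.map (weight ws) As) ≡ weight ws (⋃ As)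
weight-⋃ ws []                   = sym (weight-⊥ ws)
weight-⋃ ws {A ∷ As} (D ∷ Ds) =
  trans (cong (weight ws A ℕ.+_) (weight-⋃ ws Ds)) (sym (weight-∪ ws A (⋃ As) (Disjoint-⋃ D)))

weights-of-disjoint-≤-sum : ∀ {n} (ws : Vec ℕ n) {As : List (Subset n)} → AllPairs Disjoint As →
                            sum (List.map (weight ws) As) ℕ.≤ Vec.sum ws
weights-of-disjoint-≤-sum ws {As} Ds =
  ℕ.≤-trans (ℕ.≤-reflexive (weight-⋃ ws Ds)) (weight-≤-sum ws (⋃ As))

module _ {A : Set} {P : A → Set} where

  AllPairs-─ : ∀ {R : A → A → Set} {xs} (i : Any P xs) → AllPairs R xs → AllPairs R (xs ─ i)
  AllPairs-─ (here _)  (_ ∷ rs) = rs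
  AllPairs-─ (there i) (r ∷ rs) = All.─⁺ i r ∷ AllPairs-─ i rs

  AllPairs-lookup : ∀ {R : A → A → Set} → Symmetric R → ∀ {xs} (i : Any P xs) → AllPairs R xs →
                    All (R (Any.lookup i)) (xs ─ i)
  AllPairs-lookup sym (here _)  (r ∷ _)  = r
  AllPairs-lookup sym (there i) (r ∷ rs) = sym (proj₁ (All.lookupAny r i)) ∷ AllPairs-lookup sym i rs

  length-─ : ∀ {xs} (i : Any P xs) → length xs ≡ suc (length (xs ─ i))
  length-─ {xs} i = length-removeAt′ xs (Any.index i)

module _ where
  open ℤ.≤-Reasoning

  drop-cost : ∀ {x q : ℤ} C → 0ℤ ≤ x → q ≤ 0ℤ → C ≤ (x - q) + C
  drop-cost {x} {q} C 0≤x q≤0 = begin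
    C             ≡⟨ sym (ℤ.+-identityˡ C) ⟩
    0ℤ + C        ≤⟨ ℤ.+-monoˡ-≤ C (ℤ.i≤j⇒0≤j-i (ℤ.≤-trans q≤0 0≤x)) ⟩
    (x - q) + C   ∎

  part-cost-≤ : ∀ {x y : ℤ} q C → x ≤ y → (x - q) + C ≤ (y - q) + C
  part-cost-≤ q C x≤y = ℤ.+-monoˡ-≤ C (ℤ.+-monoˡ-≤ (- q) x≤y)

  slacked-part-cost-≤ : ∀ {x y : ℤ} {k : ℕ} q C → x ≤ y + + k → ((x - q) - + k) + C ≤ (y - q) + C
  slacked-part-cost-≤ {x} {y} {k} q C x≤y+k = ℤ.+-monoˡ-≤ C (begin
    (x - q) - + k         ≡⟨ swap x q (+ k) ⟩
    (x - + k) - q         ≤⟨ ℤ.+-monoˡ-≤ (- q) (ℤ.+-monoˡ-≤ (- + k) x≤y+k) ⟩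
    ((y + + k) - + k) - q ≡⟨ cong (_- q) (cancel y (+ k)) ⟩
    y - q                 ∎)
    where
    swap : ∀ x q k → (x - q) - k ≡ (x - k) - q
    swap = solve-∀
    cancel : ∀ y k → (y + k) - k ≡ y
    cancel = solve-∀

  uncross-cost : ∀ {x y u v pa pm pp pu : ℤ} → x + y ≤ u + v → pa + pm ≤ pp + pu →
                 (x - pp) + (y - pu) ≤ (u - pa) + (v - pm)
  uncross-cost {x} {y} {u} {v} {pa} {pm} {pp} {pu} levels supermodular = begin
    (x - pp) + (y - pu) ≡⟨ regroup x y pp pu ⟩
    (x + y) - (pp + pu) ≤⟨ ℤ.+-mono-≤ levels (ℤ.neg-mono-≤ supermodular) ⟩
    (u + v) - (pa + pm) ≡⟨ sym (regroup u v pa pm) ⟩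
    (u - pa) + (v - pm) ∎
    where
    regroup : ∀ x y p q → (x - p) + (y - q) ≡ (x + y) - (p + q)
    regroup = solve-∀

  merge-budget : ∀ {q : ℤ} i₁ i₂ j₁ j₂ F q′ → q ≡ j₂ + q′ → i₁ + i₂ ≤ j₁ + j₂ →
                 i₁ + (i₂ + (F + q′)) ≤ j₁ + (F + q)
  merge-budget {q} i₁ i₂ j₁ j₂ F q′ q≡ i≤j = begin
    i₁ + (i₂ + (F + q′)) ≡⟨ assoc i₁ i₂ (F + q′) ⟩
    (i₁ + i₂) + (F + q′) ≤⟨ ℤ.+-monoˡ-≤ (F + q′) i≤j ⟩
    (j₁ + j₂) + (F + q′) ≡⟨ regroup j₁ j₂ F q′ ⟩
    j₁ + (F + (j₂ + q′)) ≡⟨ cong (λ z → j₁ + (F + z)) (sym q≡) ⟩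
    j₁ + (F + q)         ∎
    where
    assoc : ∀ a b c → a + (b + c) ≡ (a + b) + c
    assoc = solve-∀
    regroup : ∀ a b F q → (a + b) + (F + q) ≡ a + (F + (b + q))
    regroup = solve-∀

module _ {n : ℕ} (p : SetFn n) where

  familyCost : ℤ → List (Subset n) → ℤ
  familyCost x = foldr (λ W c → (x - p W) + c) 0ℤ

  objective≡familyCost : ∀ {s} (X : Subset s) Z 𝒯 →
    b0-objective p X Z 𝒯 ≡ + ∣ ∁ Z ∣ * + ∣ X ∣ + familyCost (+ ∣ X ∣) 𝒯
  objective≡familyCost X Z = go (+ ∣ ∁ Z ∣) (+ ∣ X ∣)
    where
    go : ∀ c x 𝒯 → c * x - p̃ p 𝒯 + + length 𝒯 * x ≡ c * x + familyCost x 𝒯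
    go c x []      = empty c x
      where
      empty : ∀ c x → c * x - 0ℤ + 0ℤ * x ≡ c * x + 0ℤ
      empty = solve-∀
    go c x (W ∷ 𝒯) = begin
      c * x - (p W + p̃ p 𝒯) + (+ 1 + + length 𝒯) * x ≡⟨ split c x (p W) (p̃ p 𝒯) (+ length 𝒯) ⟩
      (c * x - p̃ p 𝒯 + + length 𝒯 * x) + (x - p W)  ≡⟨ cong (_+ (x - p W)) (go c x 𝒯) ⟩
      (c * x + familyCost x 𝒯) + (x - p W)           ≡⟨ merge c x (p W) (familyCost x 𝒯) ⟩
      c * x + ((x - p W) + familyCost x 𝒯)           ∎
      where
      open ≡-Reasoning
      split : ∀ c x w P l → c * x - (w + P) + (+ 1 + l) * x ≡ (c * x - P + l * x) + (x - w)
      split = solve-∀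
      merge : ∀ c x w F → (c * x + F) + (x - w) ≡ c * x + ((x - w) + F)
      merge = solve-∀

-- The sizes |X₁ ∩ X₂| = a, |X₁| = a + d, |X₂| = a + e and |X₁ ∪ X₂| = a + d + e.
module Levels (a d e : ℕ) where

  x∩ x₁ x₂ x∪ : ℤ
  x∩ = + a
  x₁ = x∩ + + d
  x₂ = x∩ + + e
  x∪ = x₁ + + e

  x∩≤x₁ : x∩ ≤ x₁
  x∩≤x₁ = +≤+ (ℕ.m≤m+n a d)

  x∩≤x₂ : x∩ ≤ x₂
  x∩≤x₂ = +≤+ (ℕ.m≤m+n a e)

  x∪≡x₂+d : x∪ ≡ x₂ + + d
  x∪≡x₂+d = cong +_ (trans (ℕ.+-assoc a d e) (trans (cong (a ℕ.+_) (ℕ.+-comm d e)) (sym (ℕ.+-assoc a e d))))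

  -- The surplus of an element of Z₁ ∖ Z₂ or Z₂ ∖ Z₁ in complement-cost below.
  slack : Bool → Bool → ℕ
  slack inside  inside  = 0
  slack inside  outside = e
  slack outside inside  = d
  slack outside outside = 0

  slacks : ∀ {n} → Subset n → Subset n → Vec ℕ n
  slacks = zipWith slack

  ComplementCost : ∀ {n} → Subset n → Subset n → Set
  ComplementCost Z₁ Z₂ =
    + ∣ ∁ Z₁ ∣ * x₁ + + ∣ ∁ Z₂ ∣ * x₂ ≡
    + ∣ ∁ (Z₁ ∩ Z₂) ∣ * x∩ + + ∣ ∁ (Z₁ ∪ Z₂) ∣ * x∪ + + Vec.sum (slacks Z₁ Z₂)

  private
    step : ∀ (u₁ u₂ u∩ u∪ t : ℤ) {n} (Z₁ Z₂ : Subset n) →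
      u₁ * x₁ + u₂ * x₂ ≡ u∩ * x∩ + u∪ * x∪ + t → ComplementCost Z₁ Z₂ →
      (u₁ + + ∣ ∁ Z₁ ∣) * x₁ + (u₂ + + ∣ ∁ Z₂ ∣) * x₂ ≡
      (u∩ + + ∣ ∁ (Z₁ ∩ Z₂) ∣) * x∩ + (u∪ + + ∣ ∁ (Z₁ ∪ Z₂) ∣) * x∪ + (t + + Vec.sum (slacks Z₁ Z₂))
    step u₁ u₂ u∩ u∪ t Z₁ Z₂ this rest = begin
      (u₁ + c₁) * x₁ + (u₂ + c₂) * x₂                     ≡⟨ split u₁ c₁ u₂ c₂ x₁ x₂ ⟩
      (u₁ * x₁ + u₂ * x₂) + (c₁ * x₁ + c₂ * x₂)           ≡⟨ cong₂ _+_ this rest ⟩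
      (u∩ * x∩ + u∪ * x∪ + t) + (c∩ * x∩ + c∪ * x∪ + s)   ≡⟨ join u∩ c∩ u∪ c∪ x∩ x∪ t s ⟩
      (u∩ + c∩) * x∩ + (u∪ + c∪) * x∪ + (t + s)           ∎
      where
      open ≡-Reasoning
      c₁ = + ∣ ∁ Z₁ ∣
      c₂ = + ∣ ∁ Z₂ ∣
      c∩ = + ∣ ∁ (Z₁ ∩ Z₂) ∣
      c∪ = + ∣ ∁ (Z₁ ∪ Z₂) ∣
      s = + Vec.sum (slacks Z₁ Z₂)
      split : ∀ u₁ c₁ u₂ c₂ x₁ x₂ →
        (u₁ + c₁) * x₁ + (u₂ + c₂) * x₂ ≡ (u₁ * x₁ + u₂ * x₂) + (c₁ * x₁ + c₂ * x₂)
      split = solve-∀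
      join : ∀ u∩ c∩ u∪ c∪ x∩ x∪ t s →
        (u∩ * x∩ + u∪ * x∪ + t) + (c∩ * x∩ + c∪ * x∪ + s) ≡ (u∩ + c∩) * x∩ + (u∪ + c∪) * x∪ + (t + s)
      join = solve-∀

  complement-cost : ∀ {n} (Z₁ Z₂ : Subset n) → ComplementCost Z₁ Z₂
  complement-cost []             []             = refl
  complement-cost (inside  ∷ Z₁) (inside  ∷ Z₂) = complement-cost Z₁ Z₂
  complement-cost (inside  ∷ Z₁) (outside ∷ Z₂) =
    step 0ℤ (+ 1) (+ 1) 0ℤ (+ e) Z₁ Z₂ (only₁ (+ a) (+ d) (+ e)) (complement-cost Z₁ Z₂)
    where
    only₁ : ∀ a d e → 0ℤ * (a + d) + + 1 * (a + e) ≡ + 1 * a + 0ℤ * (a + d + e) + e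
    only₁ = solve-∀
  complement-cost (outside ∷ Z₁) (inside  ∷ Z₂) =
    step (+ 1) 0ℤ (+ 1) 0ℤ (+ d) Z₁ Z₂ (only₂ (+ a) (+ d) (+ e)) (complement-cost Z₁ Z₂)
    where
    only₂ : ∀ a d e → + 1 * (a + d) + 0ℤ * (a + e) ≡ + 1 * a + 0ℤ * (a + d + e) + d
    only₂ = solve-∀
  complement-cost (outside ∷ Z₁) (outside ∷ Z₂) =
    step (+ 1) (+ 1) (+ 1) (+ 1) 0ℤ Z₁ Z₂ (neither (+ a) (+ d) (+ e)) (complement-cost Z₁ Z₂)
    where
    neither : ∀ a d e → + 1 * (a + d) + + 1 * (a + e) ≡ + 1 * a + + 1 * (a + d + e) + 0ℤ
    neither = solve-∀


  slacks-on-Z₁∖Z₂ : ∀ {n} {Z₁ Z₂ : Subset n} {u} → u ∈ Z₁ → u ∉ Z₂ → Vec.lookup (slacks Z₁ Z₂) u ≡ e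
  slacks-on-Z₁∖Z₂ {Z₁ = inside ∷ _} {inside  ∷ _} here u∉Z₂ = ⊥-elim (u∉Z₂ here)
  slacks-on-Z₁∖Z₂ {Z₁ = inside ∷ _} {outside ∷ _} here _    = refl
  slacks-on-Z₁∖Z₂ {Z₁ = _ ∷ _}      {_ ∷ _}       (there u∈Z₁) u∉Z₂ = slacks-on-Z₁∖Z₂ u∈Z₁ (u∉Z₂ ∘ there)

  slacks-on-Z₂∖Z₁ : ∀ {n} {Z₁ Z₂ : Subset n} {u} → u ∉ Z₁ → u ∈ Z₂ → Vec.lookup (slacks Z₁ Z₂) u ≡ d
  slacks-on-Z₂∖Z₁ {Z₁ = inside  ∷ _} {inside ∷ _} u∉Z₁ here = ⊥-elim (u∉Z₁ here)
  slacks-on-Z₂∖Z₁ {Z₁ = outside ∷ _} {inside ∷ _} _    here = refl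
  slacks-on-Z₂∖Z₁ {Z₁ = _ ∷ _}       {_ ∷ _}      u∉Z₁ (there u∈Z₂) = slacks-on-Z₂∖Z₁ (u∉Z₁ ∘ there) u∈Z₂

-- Uncrossing

-- The parts T of 𝒯₁ are taken one at a time as the head. The queue Q holds the parts of 𝒯₂
-- (tag initial) and the unions built so far (tag merged). The head absorbs every queue entry it
-- meets; once it meets none, a merged head joins the queue and an initial one is settled into
-- 𝒜 or ℬ. R and S are the regions already covered by 𝒜 and by ℬ.
module Uncrossing {n : ℕ} (p : SetFn n) (supermodular : PosIntersectingSupermodular p)
                  (a d e : ℕ) (Z₁ Z₂ : Subset n) where

  open Levels a d e
  open ℤ.≤-Reasoning

  data Tag : Set where
    initial merged : Tag

  Entry : Set
  Entry = Tag × Subset n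

  headLevel queueLevel : Tag → ℤ
  headLevel  initial = x₁
  headLevel  merged  = x∪
  queueLevel initial = x₂
  queueLevel merged  = x∪

  headCost entryCost : Entry → ℤ
  headCost  h = headLevel  (proj₁ h) - p (proj₂ h)
  entryCost q = queueLevel (proj₁ q) - p (proj₂ q)

  queueCost : List Entry → ℤ
  queueCost = foldr (λ q c → entryCost q + c) 0ℤ

  budget : List (Subset n) → List Entry → ℤ
  budget T Q = familyCost p x₁ T + queueCost Q

  slackTotal : List (Subset n) → ℕ
  slackTotal ℬ = sum (List.map (weight (slacks Z₁ Z₂)) ℬ)

  0≤headLevel : ∀ t → 0ℤ ≤ headLevel t
  0≤headLevel initial = +≤+ ℕ.z≤n
  0≤headLevel merged  = +≤+ ℕ.z≤n

  0≤queueLevel : ∀ t → 0ℤ ≤ queueLevel t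
  0≤queueLevel initial = +≤+ ℕ.z≤n
  0≤queueLevel merged  = +≤+ ℕ.z≤n

  -- Two parts of 𝒯₁, or two parts of 𝒯₂, never meet: that case would not be paid for.
  levels-budget : ∀ t t′ → x∩ + x∪ ≤ headLevel t + queueLevel t′
  levels-budget initial initial = ℤ.≤-reflexive (balance (+ a) (+ d) (+ e))
    where
    balance : ∀ a d e → a + ((a + d) + e) ≡ (a + d) + (a + e)
    balance = solve-∀
  levels-budget initial merged  = ℤ.+-monoˡ-≤ x∪ x∩≤x₁
  levels-budget merged  t′      = begin
    x∩ + x∪            ≤⟨ ℤ.+-monoˡ-≤ x∪ (x∩≤queueLevel t′) ⟩
    queueLevel t′ + x∪ ≡⟨ ℤ.+-comm (queueLevel t′) x∪ ⟩
    x∪ + queueLevel t′ ∎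
    where
    x∩≤queueLevel : ∀ t → x∩ ≤ queueLevel t
    x∩≤queueLevel initial = x∩≤x₂
    x∩≤queueLevel merged  = ℤ.≤-trans x∩≤x₁ (ℤ.i≤i+j x₁ (+ e))

  queueCost-─ : ∀ {P : Entry → Set} {Q} (i : Any P Q) →
                queueCost Q ≡ entryCost (Any.lookup i) + queueCost (Q ─ i)
  queueCost-─         (here _)  = refl
  queueCost-─ {Q = q ∷ Q} (there i) =
    trans (cong (_+_ (entryCost q)) (queueCost-─ i)) (swap (entryCost q) (entryCost (Any.lookup i)) (queueCost (Q ─ i)))
    where
    swap : ∀ x y z → x + (y + z) ≡ y + (x + z)
    swap = solve-∀

  queueCost-drop : ∀ {P : Entry → Set} {Q} (i : Any P Q) → p (proj₂ (Any.lookup i)) ≤ 0ℤ →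
                   queueCost (Q ─ i) ≤ queueCost Q
  queueCost-drop i M≤0 =
    subst (queueCost (_ ─ i) ≤_) (sym (queueCost-─ i))
          (drop-cost (queueCost (_ ─ i)) (0≤queueLevel (proj₁ (Any.lookup i))) M≤0)

  record Result (R S : Subset n) (C : ℤ) : Set where
    constructor result
    field
      𝒜 ℬ            : List (Subset n)
      𝒜-subpartition : IsSubpartition (Z₁ ∩ Z₂) 𝒜
      𝒜-avoids       : All (λ P → Disjoint P R) 𝒜
      ℬ-subpartition : IsSubpartition (Z₁ ∪ Z₂) ℬ
      ℬ-avoids       : All (λ V → Disjoint V S) ℬ
      bound          : familyCost p x∩ 𝒜 + familyCost p x∪ ℬ ≤ C + + slackTotal ℬ

  empty-result : ∀ {R S} → Result R S 0ℤ
  empty-result = result [] [] ([] , []) [] ([] , []) [] ℤ.≤-refl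

  weaken : ∀ {R S C C′} → C ≤ C′ → Result R S C → Result R S C′
  weaken C≤C′ (result 𝒜 ℬ 𝒜-sub 𝒜-avoids ℬ-sub ℬ-avoids bound) =
    result 𝒜 ℬ 𝒜-sub 𝒜-avoids ℬ-sub ℬ-avoids (ℤ.≤-trans bound (ℤ.+-monoˡ-≤ _ C≤C′))

  add𝒜 : ∀ {R S C} P → Nonempty P → P ⊆ Z₁ ∩ Z₂ → Disjoint P R →
         Result (R ∪ P) S C → Result R S ((x∩ - p P) + C)
  add𝒜 {C = C} P P≢∅ P⊆Z₁∩Z₂ P∩R≡∅ (result 𝒜 ℬ (𝒜-parts , 𝒜-disjoint) 𝒜-avoids ℬ-sub ℬ-avoids bound) =
    result (P ∷ 𝒜) ℬ
      ((P≢∅ , P⊆Z₁∩Z₂) ∷ 𝒜-parts , All.map (Disjoint-sym ∘ Disjoint-⊆ʳ ∪⁺ʳ) 𝒜-avoids ∷ 𝒜-disjoint)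
      (P∩R≡∅ ∷ All.map (Disjoint-⊆ʳ ∪⁺ˡ) 𝒜-avoids) ℬ-sub ℬ-avoids
      (begin
        ((x∩ - p P) + familyCost p x∩ 𝒜) + familyCost p x∪ ℬ ≡⟨ ℤ.+-assoc (x∩ - p P) _ _ ⟩
        (x∩ - p P) + (familyCost p x∩ 𝒜 + familyCost p x∪ ℬ) ≤⟨ ℤ.+-monoʳ-≤ (x∩ - p P) bound ⟩
        (x∩ - p P) + (C + + slackTotal ℬ)                     ≡⟨ sym (ℤ.+-assoc (x∩ - p P) C _) ⟩
        ((x∩ - p P) + C) + + slackTotal ℬ                     ∎)

  addℬ : ∀ {R S C} V → Nonempty V → V ⊆ Z₁ ∪ Z₂ → Disjoint V S →
         Result R (S ∪ V) C → Result R S (((x∪ - p V) - + weight (slacks Z₁ Z₂) V) + C)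
  addℬ {C = C} V V≢∅ V⊆Z₁∪Z₂ V∩S≡∅ (result 𝒜 ℬ 𝒜-sub 𝒜-avoids (ℬ-parts , ℬ-disjoint) ℬ-avoids bound) =
    result 𝒜 (V ∷ ℬ) 𝒜-sub 𝒜-avoids
      ((V≢∅ , V⊆Z₁∪Z₂) ∷ ℬ-parts , All.map (Disjoint-sym ∘ Disjoint-⊆ʳ ∪⁺ʳ) ℬ-avoids ∷ ℬ-disjoint)
      (V∩S≡∅ ∷ All.map (Disjoint-⊆ʳ ∪⁺ˡ) ℬ-avoids)
      (begin
        F𝒜 + ((x∪ - p V) + Fℬ)         ≡⟨ pull F𝒜 (x∪ - p V) Fℬ ⟩
        (x∪ - p V) + (F𝒜 + Fℬ)         ≤⟨ ℤ.+-monoʳ-≤ (x∪ - p V) bound ⟩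
        (x∪ - p V) + (C + s)           ≡⟨ shift (x∪ - p V) w C s ⟩
        (((x∪ - p V) - w) + C) + (w + s) ∎)
    where
    F𝒜 = familyCost p x∩ 𝒜
    Fℬ = familyCost p x∪ ℬ
    w = + weight (slacks Z₁ Z₂) V
    s = + slackTotal ℬ
    pull : ∀ a b c → a + (b + c) ≡ b + (a + c)
    pull = solve-∀
    shift : ∀ k w C s → k + (C + s) ≡ ((k - w) + C) + (w + s)
    shift = solve-∀

  InitialEntry : Subset n → Entry → Set
  InitialEntry R (initial , M) = M ⊆ Z₂ × Disjoint M R
  InitialEntry R (merged  , M) = ⊤

  record EntryOk (R S : Subset n) (q : Entry) : Set where
    constructor entryOk
    field
      nonempty   : Nonempty (proj₂ q)
      ⊆Z₁∪Z₂     : proj₂ q ⊆ Z₁ ∪ Z₂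
      avoids-S   : Disjoint (proj₂ q) S
      initial-ok : InitialEntry R q

  record Invariant (R S : Subset n) (T : List (Subset n)) (Q : List Entry) : Set where
    constructor invariant
    field
      T-subpartition : IsSubpartition Z₁ T
      T-avoids       : All (λ W → Disjoint W R × Disjoint W S) T
      Q-ok           : All (EntryOk R S) Q
      Q-disjoint     : AllPairs (Disjoint on proj₂) Q
      T∩Q⊆Z₂         : All (λ W → All (λ q → W ∩ proj₂ q ⊆ Z₂) Q) T

  InitialHead : Subset n → List (Subset n) → Entry → Set
  InitialHead R T (initial , A) = A ⊆ Z₁ × Disjoint A R × All (Disjoint A) T
  InitialHead R T (merged  , A) = ⊤

  record HeadOk (R S : Subset n) (T : List (Subset n)) (Q : List Entry) (h : Entry) : Set where
    constructor headOk
    field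
      nonempty   : Nonempty (proj₂ h)
      ⊆Z₁∪Z₂     : proj₂ h ⊆ Z₁ ∪ Z₂
      avoids-S   : Disjoint (proj₂ h) S
      meets-Q    : All (λ q → proj₂ h ∩ proj₂ q ⊆ Z₁ ∩ Z₂ × Disjoint (proj₂ h ∩ proj₂ q) R) Q
      meets-T    : All (λ W → W ∩ proj₂ h ⊆ Z₂ × All (λ q → Disjoint W (proj₂ h ∩ proj₂ q)) Q) T
      initial-ok : InitialHead R T h

  EntryOk-grow-R : ∀ {R S X q} → Disjoint (proj₂ q) X → EntryOk R S q → EntryOk (R ∪ X) S q
  EntryOk-grow-R {q = initial , M} M∩X≡∅ (entryOk M≢∅ M⊆ M∩S≡∅ (M⊆Z₂ , M∩R≡∅)) =
    entryOk M≢∅ M⊆ M∩S≡∅ (M⊆Z₂ , Disjoint-∪ʳ M∩R≡∅ M∩X≡∅)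
  EntryOk-grow-R {q = merged , M} _ (entryOk M≢∅ M⊆ M∩S≡∅ tt) = entryOk M≢∅ M⊆ M∩S≡∅ tt

  EntryOk-grow-S : ∀ {R S X q} → Disjoint (proj₂ q) X → EntryOk R S q → EntryOk R (S ∪ X) q
  EntryOk-grow-S M∩X≡∅ (entryOk M≢∅ M⊆ M∩S≡∅ ok) = entryOk M≢∅ M⊆ (Disjoint-∪ʳ M∩S≡∅ M∩X≡∅) ok

  grow-R : ∀ {R S T Q X} → All (λ W → Disjoint W X) T → All (λ q → Disjoint (proj₂ q) X) Q →
           Invariant R S T Q → Invariant (R ∪ X) S T Q
  grow-R T∩X≡∅ Q∩X≡∅ (invariant T-sub T-avoids Q-ok Q-disjoint T∩Q⊆Z₂) =
    invariant T-sub
      (All.zipWith (λ ((W∩R≡∅ , W∩S≡∅) , W∩X≡∅) → Disjoint-∪ʳ W∩R≡∅ W∩X≡∅ , W∩S≡∅) (T-avoids , T∩X≡∅))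
      (All.zipWith (λ (ok , M∩X≡∅) → EntryOk-grow-R M∩X≡∅ ok) (Q-ok , Q∩X≡∅))
      Q-disjoint T∩Q⊆Z₂

  grow-S : ∀ {R S T Q X} → All (λ W → Disjoint W X) T → All (λ q → Disjoint (proj₂ q) X) Q →
           Invariant R S T Q → Invariant R (S ∪ X) T Q
  grow-S T∩X≡∅ Q∩X≡∅ (invariant T-sub T-avoids Q-ok Q-disjoint T∩Q⊆Z₂) =
    invariant T-sub
      (All.zipWith (λ ((W∩R≡∅ , W∩S≡∅) , W∩X≡∅) → W∩R≡∅ , Disjoint-∪ʳ W∩S≡∅ W∩X≡∅) (T-avoids , T∩X≡∅))
      (All.zipWith (λ (ok , M∩X≡∅) → EntryOk-grow-S M∩X≡∅ ok) (Q-ok , Q∩X≡∅))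
      Q-disjoint T∩Q⊆Z₂

  promote : ∀ {R S W T Q} → Invariant R S (W ∷ T) Q → Invariant R S T Q × HeadOk R S T Q (initial , W)
  promote {R} {S} {W} {T} {Q}
    (invariant (((W≢∅ , W⊆Z₁) ∷ T-parts) , (W-apart ∷ T-disjoint)) ((W∩R≡∅ , W∩S≡∅) ∷ T-avoids)
               Q-ok Q-disjoint (W∩Q⊆Z₂ ∷ T∩Q⊆Z₂)) =
    invariant (T-parts , T-disjoint) T-avoids Q-ok Q-disjoint T∩Q⊆Z₂ ,
    headOk W≢∅ (⊆-trans W⊆Z₁ ∪⁺ˡ) W∩S≡∅ (All.map meets-entry W∩Q⊆Z₂) (All.map meets-part W-apart)
           (W⊆Z₁ , W∩R≡∅ , W-apart)
    where
    meets-entry : ∀ {M} → W ∩ M ⊆ Z₂ → W ∩ M ⊆ Z₁ ∩ Z₂ × Disjoint (W ∩ M) R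
    meets-entry W∩M⊆Z₂ = ⊆-∩⁺ (⊆-trans ∩⁻ˡ W⊆Z₁) W∩M⊆Z₂ , Disjoint-⊆ˡ ∩⁻ˡ W∩R≡∅

    meets-part : ∀ {W′} → Disjoint W W′ → W′ ∩ W ⊆ Z₂ × All (λ q → Disjoint W′ (W ∩ proj₂ q)) Q
    meets-part W∩W′≡∅ =
      Disjoint⇒∩⊆ (Disjoint-sym W∩W′≡∅) , All.universal (λ _ → Disjoint-⊆ʳ ∩⁻ˡ (Disjoint-sym W∩W′≡∅)) Q

  drop-entry : ∀ {R S T Q h} {P : Entry → Set} (i : Any P Q) → Invariant R S T Q → HeadOk R S T Q h →
               Invariant R S T (Q ─ i) × HeadOk R S T (Q ─ i) h
  drop-entry i (invariant T-sub T-avoids Q-ok Q-disjoint T∩Q⊆Z₂) (headOk A≢∅ A⊆ A∩S≡∅ meets-Q meets-T init) =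
    invariant T-sub T-avoids (All.─⁺ i Q-ok) (AllPairs-─ i Q-disjoint) (All.map (All.─⁺ i) T∩Q⊆Z₂) ,
    headOk A≢∅ A⊆ A∩S≡∅ (All.─⁺ i meets-Q) (All.map (Product.map₂ (All.─⁺ i)) meets-T) init

  merge : ∀ {R S T Q t A} (i : Any (λ q → Nonempty (A ∩ proj₂ q)) Q) →
          Invariant R S T Q → HeadOk R S T Q (t , A) →
          let M = proj₂ (Any.lookup i) in
          Invariant (R ∪ (A ∩ M)) S T (Q ─ i) × HeadOk (R ∪ (A ∩ M)) S T (Q ─ i) (merged , A ∪ M)
  merge {R} {S} {T} {Q} {t} {A} i inv head =
    grow-R (All.map part-avoids-piece meets-T) (All.map entry-avoids-piece M-apart) (proj₁ (drop-entry i inv head)) ,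
    headOk (proj₁ A≢∅ , ∪⁺ˡ (proj₂ A≢∅)) (λ x∈A∪M → [ A⊆ , EntryOk.⊆Z₁∪Z₂ M-ok ]′ (∪⁻ x∈A∪M))
           (Disjoint-∪ˡ A∩S≡∅ (EntryOk.avoids-S M-ok))
           (All.zipWith merged-meets-entry (All.─⁺ i meets-Q , M-apart))
           (All.zipWith merged-meets-part (meets-T , Invariant.T∩Q⊆Z₂ inv))
           tt
    where
    open HeadOk head renaming (nonempty to A≢∅; ⊆Z₁∪Z₂ to A⊆; avoids-S to A∩S≡∅)
    M = proj₂ (Any.lookup i)
    M-ok = proj₁ (All.lookupAny (Invariant.Q-ok inv) i)

    M-apart : All (λ q → Disjoint M (proj₂ q)) (Q ─ i)
    M-apart = AllPairs-lookup Disjoint-sym i (Invariant.Q-disjoint inv)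

    part-avoids-piece : ∀ {W} → W ∩ A ⊆ Z₂ × All (λ q → Disjoint W (A ∩ proj₂ q)) Q → Disjoint W (A ∩ M)
    part-avoids-piece (_ , W-apart) = proj₁ (All.lookupAny W-apart i)

    entry-avoids-piece : ∀ {M′} → Disjoint M M′ → Disjoint M′ (A ∩ M)
    entry-avoids-piece M∩M′≡∅ = Disjoint-⊆ʳ ∩⁻ʳ (Disjoint-sym M∩M′≡∅)

    merged-meets-entry : ∀ {M′} → (A ∩ M′ ⊆ Z₁ ∩ Z₂ × Disjoint (A ∩ M′) R) × Disjoint M M′ →
                         (A ∪ M) ∩ M′ ⊆ Z₁ ∩ Z₂ × Disjoint ((A ∪ M) ∩ M′) (R ∪ (A ∩ M))
    merged-meets-entry ((A∩M′⊆ , A∩M′∩R≡∅) , M∩M′≡∅) =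
      ⊆-trans (∪∩⊆∩ M∩M′≡∅) A∩M′⊆ ,
      Disjoint-∪ʳ (Disjoint-⊆ˡ (∪∩⊆∩ M∩M′≡∅) A∩M′∩R≡∅) (Disjoint-⊆ˡ ∩⁻ʳ (entry-avoids-piece M∩M′≡∅))

    merged-meets-part : ∀ {W} →
                        (W ∩ A ⊆ Z₂ × All (λ q → Disjoint W (A ∩ proj₂ q)) Q) × All (λ q → W ∩ proj₂ q ⊆ Z₂) Q →
                        W ∩ (A ∪ M) ⊆ Z₂ × All (λ q → Disjoint W ((A ∪ M) ∩ proj₂ q)) (Q ─ i)
    merged-meets-part ((W∩A⊆Z₂ , W-apart) , W∩Q⊆Z₂) =
      ∩∪⊆ W∩A⊆Z₂ (proj₁ (All.lookupAny W∩Q⊆Z₂ i)) ,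
      All.zipWith (λ (W∩A∩M′≡∅ , M∩M′≡∅) → Disjoint-⊆ʳ (∪∩⊆∩ M∩M′≡∅) W∩A∩M′≡∅) (All.─⁺ i W-apart , M-apart)

  push : ∀ {R S T Q A} → All (λ q → Disjoint A (proj₂ q)) Q → Invariant R S T Q → HeadOk R S T Q (merged , A) →
         Invariant R S T ((merged , A) ∷ Q)
  push A-apart (invariant T-sub T-avoids Q-ok Q-disjoint T∩Q⊆Z₂) (headOk A≢∅ A⊆ A∩S≡∅ _ meets-T _) =
    invariant T-sub T-avoids (entryOk A≢∅ A⊆ A∩S≡∅ tt ∷ Q-ok) (A-apart ∷ Q-disjoint)
      (All.zipWith (λ ((W∩A⊆Z₂ , _) , W∩Q⊆Z₂) → W∩A⊆Z₂ ∷ W∩Q⊆Z₂) (meets-T , T∩Q⊆Z₂))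

  e≤slack : ∀ {V u} → u ∈ V → u ∈ Z₁ → u ∉ Z₂ → e ℕ.≤ weight (slacks Z₁ Z₂) V
  e≤slack {V} u∈V u∈Z₁ u∉Z₂ =
    subst (ℕ._≤ weight (slacks Z₁ Z₂) V) (slacks-on-Z₁∖Z₂ u∈Z₁ u∉Z₂) (lookup-≤-weight (slacks Z₁ Z₂) u∈V)

  d≤slack : ∀ {V u} → u ∈ V → u ∉ Z₁ → u ∈ Z₂ → d ℕ.≤ weight (slacks Z₁ Z₂) V
  d≤slack {V} u∈V u∉Z₁ u∈Z₂ =
    subst (ℕ._≤ weight (slacks Z₁ Z₂) V) (slacks-on-Z₂∖Z₁ u∉Z₁ u∈Z₂) (lookup-≤-weight (slacks Z₁ Z₂) u∈V)

  flush : ∀ {R S} Q → All (EntryOk R S) Q → AllPairs (Disjoint on proj₂) Q → Result R S (queueCost Q)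
  flush [] [] [] = empty-result
  flush ((merged , M) ∷ Q) (entryOk M≢∅ M⊆ M∩S≡∅ tt ∷ Q-ok) (M-apart ∷ Q-disjoint) =
    weaken (slacked-part-cost-≤ {y = x∪} (p M) (queueCost Q) (ℤ.i≤i+j x∪ _))
      (addℬ M M≢∅ M⊆ M∩S≡∅
        (flush Q (All.zipWith (λ (ok , D) → EntryOk-grow-S (Disjoint-sym D) ok) (Q-ok , M-apart)) Q-disjoint))
  flush ((initial , M) ∷ Q) (entryOk M≢∅ M⊆ M∩S≡∅ (M⊆Z₂ , M∩R≡∅) ∷ Q-ok) (M-apart ∷ Q-disjoint)
    with ⊆-or-counterexample M Z₁
  ... | inj₁ M⊆Z₁ =
    weaken (part-cost-≤ (p M) (queueCost Q) x∩≤x₂)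
      (add𝒜 M M≢∅ (⊆-∩⁺ M⊆Z₁ M⊆Z₂) M∩R≡∅
        (flush Q (All.zipWith (λ (ok , D) → EntryOk-grow-R (Disjoint-sym D) ok) (Q-ok , M-apart)) Q-disjoint))
  ... | inj₂ (u , u∈M , u∉Z₁) =
    weaken (slacked-part-cost-≤ {y = x₂} (p M) (queueCost Q)
              (ℤ.≤-trans (ℤ.≤-reflexive x∪≡x₂+d) (ℤ.+-monoʳ-≤ x₂ (+≤+ (d≤slack u∈M u∉Z₁ (M⊆Z₂ u∈M))))))
      (addℬ M M≢∅ M⊆ M∩S≡∅
        (flush Q (All.zipWith (λ (ok , D) → EntryOk-grow-S (Disjoint-sym D) ok) (Q-ok , M-apart)) Q-disjoint))

  uncrossed-cost : ∀ t t′ {A M} → Nonempty (A ∩ M) → 0ℤ < p A → 0ℤ < p M →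
                   (x∩ - p (A ∩ M)) + (x∪ - p (A ∪ M)) ≤ headCost (t , A) + entryCost (t′ , M)
  uncrossed-cost t t′ {A} {M} A∩M≢∅ A>0 M>0 =
    uncross-cost {x∩} {x∪} {headLevel t} {queueLevel t′} {p A} {p M} {p (A ∩ M)} {p (A ∪ M)}
                 (levels-budget t t′) (supermodular A M A∩M≢∅ A>0 M>0)

  mutual
    process : ∀ R S T Q → Invariant R S T Q → Result R S (budget T Q)
    process R S [] Q inv =
      weaken (ℤ.≤-reflexive (sym (ℤ.+-identityˡ (queueCost Q))))
        (flush Q (Invariant.Q-ok inv) (Invariant.Q-disjoint inv))
    process R S (W ∷ T) Q inv =
      let inv′ , head = promote inv in
      weaken (ℤ.≤-reflexive (sym (ℤ.+-assoc (x₁ - p W) (familyCost p x₁ T) (queueCost Q))))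
        (absorb (suc (length Q)) R S T Q (initial , W) ℕ.≤-refl inv′ head)

    absorb : ∀ k R S T Q h → length Q ℕ.< k → Invariant R S T Q → HeadOk R S T Q h →
             Result R S (headCost h + budget T Q)
    absorb (suc k) R S T Q (t , A) (ℕ.s≤s fuel) inv head with 0ℤ ℤ.<? p A
    ... | no A≯0 = weaken (drop-cost (budget T Q) (0≤headLevel t) (ℤ.≮⇒≥ A≯0)) (process R S T Q inv)
    ... | yes A>0 with Any.any? (λ q → nonempty? (A ∩ proj₂ q)) Q
    ...   | no A-apart = settle R S T Q t A (All.¬Any⇒All¬ Q A-apart) inv head
    ...   | yes i with 0ℤ ℤ.<? p (proj₂ (Any.lookup i))
    ...     | no M≯0 =
      let inv′ , head′ = drop-entry i inv head in
      weaken (ℤ.+-monoʳ-≤ (headCost (t , A)) (ℤ.+-monoʳ-≤ (familyCost p x₁ T) (queueCost-drop i (ℤ.≮⇒≥ M≯0))))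
        (absorb k R S T (Q ─ i) (t , A) (subst (ℕ._≤ k) (length-─ i) fuel) inv′ head′)
    ...     | yes M>0 =
      let M = proj₂ (Any.lookup i)
          (A∩M⊆Z₁∩Z₂ , A∩M∩R≡∅) , A∩M≢∅ = All.lookupAny (HeadOk.meets-Q head) i
          inv′ , head′ = merge i inv head
      in
      weaken (merge-budget (x∩ - p (A ∩ M)) (x∪ - p (A ∪ M)) (headCost (t , A)) (entryCost (Any.lookup i))
                           (familyCost p x₁ T) (queueCost (Q ─ i)) (queueCost-─ i)
                           (uncrossed-cost t (proj₁ (Any.lookup i)) A∩M≢∅ A>0 M>0))
        (add𝒜 (A ∩ M) A∩M≢∅ A∩M⊆Z₁∩Z₂ A∩M∩R≡∅
          (absorb k (R ∪ (A ∩ M)) S T (Q ─ i) (merged , A ∪ M) (subst (ℕ._≤ k) (length-─ i) fuel) inv′ head′))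

    settle : ∀ R S T Q t A → All (λ q → Disjoint A (proj₂ q)) Q → Invariant R S T Q → HeadOk R S T Q (t , A) →
             Result R S (headCost (t , A) + budget T Q)
    settle R S T Q merged A A-apart inv head =
      weaken (ℤ.≤-reflexive (swap (familyCost p x₁ T) (x∪ - p A) (queueCost Q)))
        (process R S T ((merged , A) ∷ Q) (push A-apart inv head))
      where
      swap : ∀ F c q → F + (c + q) ≡ c + (F + q)
      swap = solve-∀
    settle R S T Q initial A A-apart inv head with ⊆-or-counterexample A Z₂
    ... | inj₁ A⊆Z₂ =
      let A⊆Z₁ , A∩R≡∅ , A-apart-T = HeadOk.initial-ok head in
      weaken (part-cost-≤ (p A) (budget T Q) x∩≤x₁)
        (add𝒜 A (HeadOk.nonempty head) (⊆-∩⁺ A⊆Z₁ A⊆Z₂) A∩R≡∅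
          (process (R ∪ A) S T Q (grow-R (All.map Disjoint-sym A-apart-T) (All.map Disjoint-sym A-apart) inv)))
    ... | inj₂ (u , u∈A , u∉Z₂) =
      let A⊆Z₁ , _ , A-apart-T = HeadOk.initial-ok head in
      weaken (slacked-part-cost-≤ {y = x₁} (p A) (budget T Q)
                (ℤ.+-monoʳ-≤ x₁ (+≤+ (e≤slack u∈A (A⊆Z₁ u∈A) u∉Z₂))))
        (addℬ A (HeadOk.nonempty head) (HeadOk.⊆Z₁∪Z₂ head) (HeadOk.avoids-S head)
          (process R (S ∪ A) T Q (grow-S (All.map Disjoint-sym A-apart-T) (All.map Disjoint-sym A-apart) inv)))

  initial-state : ∀ {𝒯₁ 𝒯₂} → IsSubpartition Z₁ 𝒯₁ → IsSubpartition Z₂ 𝒯₂ →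
                  Invariant ⊥ ⊥ 𝒯₁ (List.map (initial ,_) 𝒯₂)
  initial-state {𝒯₁} sp₁ (𝒯₂-parts , 𝒯₂-disjoint) =
    invariant sp₁ (All.universal (λ W → Disjoint-⊥ W , Disjoint-⊥ W) 𝒯₁)
      (All.map⁺ (All.map initial-entry 𝒯₂-parts)) (AllPairs.map⁺ 𝒯₂-disjoint)
      (All.universal (λ W → All.map⁺ (All.map (meets-Z₂ W) 𝒯₂-parts)) 𝒯₁)
    where
    initial-entry : ∀ {M} → Nonempty M × M ⊆ Z₂ → EntryOk ⊥ ⊥ (initial , M)
    initial-entry (M≢∅ , M⊆Z₂) = entryOk M≢∅ (⊆-trans M⊆Z₂ ∪⁺ʳ) (Disjoint-⊥ _) (M⊆Z₂ , Disjoint-⊥ _)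

    meets-Z₂ : ∀ W {M} → Nonempty M × M ⊆ Z₂ → W ∩ M ⊆ Z₂
    meets-Z₂ W (_ , M⊆Z₂) = ⊆-trans ∩⁻ʳ M⊆Z₂

  queueCost-initial : ∀ 𝒯 → queueCost (List.map (initial ,_) 𝒯) ≡ familyCost p x₂ 𝒯
  queueCost-initial []      = refl
  queueCost-initial (M ∷ 𝒯) = cong (_+_ (x₂ - p M)) (queueCost-initial 𝒯)

  uncross : ∀ {𝒯₁ 𝒯₂} → IsSubpartition Z₁ 𝒯₁ → IsSubpartition Z₂ 𝒯₂ →
    ∃₂ λ 𝒜 ℬ → IsSubpartition (Z₁ ∩ Z₂) 𝒜 × IsSubpartition (Z₁ ∪ Z₂) ℬ ×
      (+ ∣ ∁ (Z₁ ∩ Z₂) ∣ * x∩ + familyCost p x∩ 𝒜) + (+ ∣ ∁ (Z₁ ∪ Z₂) ∣ * x∪ + familyCost p x∪ ℬ) ≤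
      (+ ∣ ∁ Z₁ ∣ * x₁ + familyCost p x₁ 𝒯₁) + (+ ∣ ∁ Z₂ ∣ * x₂ + familyCost p x₂ 𝒯₂)
  uncross {𝒯₁} {𝒯₂} sp₁ sp₂ =
    let result 𝒜 ℬ 𝒜-sub _ ℬ-sub _ bound = process ⊥ ⊥ 𝒯₁ (List.map (initial ,_) 𝒯₂) (initial-state sp₁ sp₂)
        c∩ = + ∣ ∁ (Z₁ ∩ Z₂) ∣ * x∩
        c∪ = + ∣ ∁ (Z₁ ∪ Z₂) ∣ * x∪
        F₁ = familyCost p x₁ 𝒯₁
        F₂ = familyCost p x₂ 𝒯₂
        σ = Vec.sum (slacks Z₁ Z₂)
    in
    𝒜 , ℬ , 𝒜-sub , ℬ-sub , (begin
      (c∩ + familyCost p x∩ 𝒜) + (c∪ + familyCost p x∪ ℬ) ≡⟨ interchange c∩ _ c∪ _ ⟩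
      (c∩ + c∪) + (familyCost p x∩ 𝒜 + familyCost p x∪ ℬ) ≤⟨ ℤ.+-monoʳ-≤ (c∩ + c∪) (ℤ.≤-trans bound
          (ℤ.+-mono-≤ (ℤ.≤-reflexive (cong (_+_ F₁) (queueCost-initial 𝒯₂)))
                      (+≤+ (weights-of-disjoint-≤-sum (slacks Z₁ Z₂) (proj₂ ℬ-sub))))) ⟩
      (c∩ + c∪) + ((F₁ + F₂) + + σ)                       ≡⟨ rotate (c∩ + c∪) (F₁ + F₂) (+ σ) ⟩
      (c∩ + c∪ + + σ) + (F₁ + F₂)                         ≡⟨ cong (_+ (F₁ + F₂)) (sym (complement-cost Z₁ Z₂)) ⟩
      (+ ∣ ∁ Z₁ ∣ * x₁ + + ∣ ∁ Z₂ ∣ * x₂) + (F₁ + F₂)     ≡⟨ interchange (+ ∣ ∁ Z₁ ∣ * x₁) _ _ _ ⟩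
      (+ ∣ ∁ Z₁ ∣ * x₁ + F₁) + (+ ∣ ∁ Z₂ ∣ * x₂ + F₂)     ∎)
    where
    interchange : ∀ a b c d → (a + b) + (c + d) ≡ (a + c) + (b + d)
    interchange = solve-∀
    rotate : ∀ c F s → c + (F + s) ≡ (c + s) + F
    rotate = solve-∀

b0-objective-uncrosses : ∀ {s n} (p : SetFn n) → PosIntersectingSupermodular p →
  ∀ (X₁ X₂ : Subset s) {Z₁ Z₂ 𝒯₁ 𝒯₂} → IsSubpartition Z₁ 𝒯₁ → IsSubpartition Z₂ 𝒯₂ →
  ∃₂ λ 𝒜 ℬ → IsSubpartition (Z₁ ∩ Z₂) 𝒜 × IsSubpartition (Z₁ ∪ Z₂) ℬ ×
    b0-objective p (X₁ ∩ X₂) (Z₁ ∩ Z₂) 𝒜 + b0-objective p (X₁ ∪ X₂) (Z₁ ∪ Z₂) ℬ ≤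
    b0-objective p X₁ Z₁ 𝒯₁ + b0-objective p X₂ Z₂ 𝒯₂
b0-objective-uncrosses p supermodular X₁ X₂ {Z₁} {Z₂} {𝒯₁} {𝒯₂} sp₁ sp₂ =
  let 𝒜 , ℬ , 𝒜-sub , ℬ-sub , uncrossed = uncross sp₁ sp₂ in
  𝒜 , ℬ , 𝒜-sub , ℬ-sub ,
  subst₂ _≤_ (sym (cong₂ _+_ (objective (X₁ ∩ X₂) (Z₁ ∩ Z₂) 𝒜 refl)
                             (objective (X₁ ∪ X₂) (Z₁ ∪ Z₂) ℬ ∣X₁∪X₂∣≡)))
             (sym (cong₂ _+_ (objective X₁ Z₁ 𝒯₁ ∣X₁∣≡) (objective X₂ Z₂ 𝒯₂ ∣X₂∣≡)))
             uncrossed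
  where
  a = ∣ X₁ ∩ X₂ ∣
  d = ∣ X₁ ∣ ∸ a
  e = ∣ X₂ ∣ ∸ a
  open Uncrossing p supermodular a d e Z₁ Z₂
  open Levels a d e

  objective : ∀ X Z 𝒯 {x} → + ∣ X ∣ ≡ x → b0-objective p X Z 𝒯 ≡ + ∣ ∁ Z ∣ * x + familyCost p x 𝒯
  objective X Z 𝒯 refl = objective≡familyCost p X Z 𝒯

  a+d≡ : a ℕ.+ d ≡ ∣ X₁ ∣
  a+d≡ = ℕ.m+[n∸m]≡n (∣p∩q∣≤∣p∣ X₁ X₂)

  a+e≡ : a ℕ.+ e ≡ ∣ X₂ ∣
  a+e≡ = ℕ.m+[n∸m]≡n (∣p∩q∣≤∣q∣ X₁ X₂)

  ∣X₁∣≡ : + ∣ X₁ ∣ ≡ x₁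
  ∣X₁∣≡ = cong +_ (sym a+d≡)

  ∣X₂∣≡ : + ∣ X₂ ∣ ≡ x₂
  ∣X₂∣≡ = cong +_ (sym a+e≡)

  ∣X₁∪X₂∣≡ : + ∣ X₁ ∪ X₂ ∣ ≡ x∪
  ∣X₁∪X₂∣≡ = cong +_ (ℕ.+-cancelˡ-≡ a _ _ (begin
    a ℕ.+ ∣ X₁ ∪ X₂ ∣              ≡⟨ ∣p∩q∣+∣p∪q∣≡∣p∣+∣q∣ X₁ X₂ ⟩
    ∣ X₁ ∣ ℕ.+ ∣ X₂ ∣              ≡⟨ sym (cong₂ ℕ._+_ a+d≡ a+e≡) ⟩
    (a ℕ.+ d) ℕ.+ (a ℕ.+ e)        ≡⟨ shuffle a d e ⟩
    a ℕ.+ ((a ℕ.+ d) ℕ.+ e)        ∎))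
    where
    open ≡-Reasoning
    shuffle : ∀ a d e → (a ℕ.+ d) ℕ.+ (a ℕ.+ e) ≡ a ℕ.+ ((a ℕ.+ d) ℕ.+ e)
    shuffle = ℕ-Solver.solve-∀

theorem15 : (s t : ℕ) → (p : SetFn (suc t)) →
    PosIntersectingSupermodular p → p ⊥ ≡ + 0 → (∀ Y → p Y ≤ + suc s) →
    (b0 : Subset (suc s) → Subset (suc t) → ℤ) →
    (∀ X Z → IsMinObjective p X Z (b0 X Z)) →
    ∀ X₁ Z₁ X₂ Z₂ →
    b0 (X₁ ∩ X₂) (Z₁ ∩ Z₂) + b0 (X₁ ∪ X₂) (Z₁ ∪ Z₂) ≤ b0 X₁ Z₁ + b0 X₂ Z₂
theorem15 s t p supermodular _ _ b0 b0-minimum X₁ Z₁ X₂ Z₂ =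
  let (𝒯₁ , sp₁ , attained₁) , _ = b0-minimum X₁ Z₁
      (𝒯₂ , sp₂ , attained₂) , _ = b0-minimum X₂ Z₂
      𝒜 , ℬ , 𝒜-sub , ℬ-sub , uncrossed = b0-objective-uncrosses p supermodular X₁ X₂ sp₁ sp₂
  in begin
    b0 (X₁ ∩ X₂) (Z₁ ∩ Z₂) + b0 (X₁ ∪ X₂) (Z₁ ∪ Z₂)
      ≤⟨ ℤ.+-mono-≤ (proj₂ (b0-minimum (X₁ ∩ X₂) (Z₁ ∩ Z₂)) 𝒜 𝒜-sub)
                    (proj₂ (b0-minimum (X₁ ∪ X₂) (Z₁ ∪ Z₂)) ℬ ℬ-sub) ⟩
    b0-objective p (X₁ ∩ X₂) (Z₁ ∩ Z₂) 𝒜 + b0-objective p (X₁ ∪ X₂) (Z₁ ∪ Z₂) ℬ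
      ≤⟨ uncrossed ⟩
    b0-objective p X₁ Z₁ 𝒯₁ + b0-objective p X₂ Z₂ 𝒯₂
      ≡⟨ cong₂ _+_ attained₁ attained₂ ⟩
    b0 X₁ Z₁ + b0 X₂ Z₂ ∎
  where open ℤ.≤-Reasoning
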